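{- Let $0\le k\le K$ be integers and let $\mathcal{T}=\mathcal{T}_{K+1,k+1}$ be the $(K+1,k+1)$-biregular tree, with vertex set $L_{\mathcal{T}}\sqcup R_{\mathcal{T}}$ (vertices in $L_{\mathcal{T}}$ have degree $K+1$, vertices in $R_{\mathcal{T}}$ have degree $k+1$). Let $\Lambda$ be a group acting on $\mathcal{T}$ by graph automorphisms such that the action is simply transitive on $L_{\mathcal{T}}$. Fix $v_0\in L_{\mathcal{T}}$ and let $v_1,\dots,v_{K+1}\in R_{\mathcal{T}}$ be its neighbors. For $i\in\{1,\dots,K+1\}$ put $$S^i=\{1\neq s\in\Lambda \mid \mathrm{dist}(sv_0,v_i)=1\}.$$ Then $(\Lambda,(S^1,\dots,S^{K+1}))$ satisfies the bi-Cayley axioms, and the Cayley bigraph $CayB(\Lambda,(S^i)_i)=(L\sqcup R,E)$ is isomorphic to $\mathcal{T}$ via the map $f$ given by $f(g)=gv_0$ for $g\in L=\Lambda$ and $f([g,i])=gv_i$ for $[g,i]\in R$.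
   Context: Let $G$ be a group and $S^1,\dots,S^{K+1}\subseteq G$ pairwise disjoint subsets each of size $k$; put $S=\bigsqcup_i S^i$ and define $i:S\to\{1,\dots,K+1\}$ by $s\in S^{i(s)}$. The pair $(G,(S^i))$ satisfies the bi-Cayley axioms if (1) $S=S^{ -1}$ and $1\notin S$, and (2) whenever $s,t\in S^i$, either $s=t$ or $s^{ -1}t\in S^{i(s^{ -1})}$. In that case define a relation on $G\times\{1,\dots,K+1\}$ by $(g_1,j_1)\sim(g_2,j_2)$ iff either $(g_1,j_1)=(g_2,j_2)$, or $g_1^{ -1}g_2\in S^{j_1}$ and $g_2^{ -1}g_1\in S^{j_2}$; it is an equivalence relation, and $[g,j]$ denotes the class of $(g,j)$. The Cayley bigraph $CayB(G,(S^i))$ is the bipartite graph with left vertices $L=G$, right vertices $R=(G\times\{1,\dots,K+1\})/\sim$, and edges $\{g,[g,i]\}$ for $g\in G$, $i\in\{1,\dots,K+1\}$. -}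

module Defs where

open import Level using (Level; _⊔_)
open import Data.Nat using (ℕ; suc; _≤_)
open import Data.Fin using (Fin)
open import Data.Product using (Σ; ∃; ∃-syntax; _×_; _,_)
open import Data.Sum using (_⊎_; inj₁; inj₂)
open import Data.Empty using (⊥)
open import Data.Maybe using (just)
open import Data.List using (List; []; _∷_; _++_; [_]; length; head; last)
open import Data.List.Relation.Unary.Linked using (Linked)
open import Data.List.Relation.Unary.Unique.Propositional using (Unique)
open import Relation.Nullary using (¬_)
open import Relation.Binary.PropositionalEquality using (_≡_)
open import Algebra.Bundles using (Group)
open import Function using (_⇔_)

record BiGraph : Set₁ where
  field
    L : Set
    R : Set
    E : L → R → Set

module _ (Γ : BiGraph) where
  open BiGraph Γ

  Vtx : Set
  Vtx = L ⊎ R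

  Adj : Vtx → Vtx → Set
  Adj (inj₁ l) (inj₂ r) = E l r
  Adj (inj₂ r) (inj₁ l) = E l r
  Adj (inj₁ _) (inj₁ _) = ⊥
  Adj (inj₂ _) (inj₂ _) = ⊥

  Connected : Set
  Connected = ∀ (u w : Vtx) →
    ∃[ xs ] (Linked Adj xs × head xs ≡ just u × last xs ≡ just w)

  Cycle : Set
  Cycle = Σ Vtx λ v → Σ (List Vtx) λ ws →
    2 ≤ length ws × Unique (v ∷ ws) × Linked Adj (v ∷ ws ++ [ v ])

  IsTree : Set
  IsTree = Connected × ¬ Cycle

  NeighbourListL : (n : ℕ) → L → (Fin n → R) → Set
  NeighbourListL n l nb =
    (∀ i j → nb i ≡ nb j → i ≡ j) × (∀ i → E l (nb i)) ×
    (∀ r → E l r → ∃[ i ] nb i ≡ r)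

  NeighbourListR : (n : ℕ) → R → (Fin n → L) → Set
  NeighbourListR n r nb =
    (∀ i j → nb i ≡ nb j → i ≡ j) × (∀ i → E (nb i) r) ×
    (∀ l → E l r → ∃[ i ] nb i ≡ l)

  IsBiregular : ℕ → ℕ → Set
  IsBiregular a b =
    (∀ l → Σ (Fin a → R) (NeighbourListL a l)) ×
    (∀ r → Σ (Fin b → L) (NeighbourListR b r))

  -- the (a,b)-biregular tree (unique up to isomorphism)
  IsBiregularTree : ℕ → ℕ → Set
  IsBiregularTree a b = IsTree × IsBiregular a b

module _ {c ℓ : Level} (G : Group c ℓ) (Γ : BiGraph) where
  open Group G
  open BiGraph Γ

  record Action : Set (c ⊔ ℓ) where
    field
      actL   : Carrier → L → L
      actR   : Carrier → R → R
      actL-ε : ∀ x → actL ε x ≡ x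
      actR-ε : ∀ x → actR ε x ≡ x
      actL-∙ : ∀ g h x → actL (g ∙ h) x ≡ actL g (actL h x)
      actR-∙ : ∀ g h x → actR (g ∙ h) x ≡ actR g (actR h x)
      actL-≈ : ∀ {g h} → g ≈ h → ∀ x → actL g x ≡ actL h x
      actR-≈ : ∀ {g h} → g ≈ h → ∀ x → actR g x ≡ actR h x
      act-E  : ∀ g l r → E l r ⇔ E (actL g l) (actR g r)

  SimplyTransitiveOnL : Action → Set (c ⊔ ℓ)
  SimplyTransitiveOnL α =
    (∀ x y → ∃[ g ] actL g x ≡ y) ×
    (∀ g h x → actL g x ≡ actL h x → g ≈ h)
    where open Action α

-- Bi-Cayley axioms and Cayley bigraphs, for a family of subsets
-- S : Fin (K+1) → (Carrier → Set) (indices 0..K stand for 1..K+1)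

module _ {c ℓ : Level} (G : Group c ℓ) where
  open Group G

  -- the subset P (assumed ≈-closed) has exactly k elements
  HasSize : ℕ → (Carrier → Set ℓ) → Set (c ⊔ ℓ)
  HasSize k P = Σ (Fin k → Carrier) λ e →
    (∀ j → P (e j)) × (∀ i j → e i ≈ e j → i ≡ j) ×
    (∀ s → P s → ∃[ j ] e j ≈ s)

  module _ {K : ℕ} (S : Fin (suc K) → Carrier → Set ℓ) where

    _∈S : Carrier → Set ℓ
    s ∈S = ∃[ i ] S i s

    BiCayley : ℕ → Set (c ⊔ ℓ)
    BiCayley k =
      (∀ i s t → s ≈ t → S i s → S i t) ×
      (∀ i → HasSize k (S i)) ×
      (∀ i j s → S i s → S j s → i ≡ j) ×
      (∀ s → s ∈S → (s ⁻¹) ∈S) × ¬ (ε ∈S) ×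
      -- axiom (2): s, t ∈ Sⁱ ⇒ s = t or s⁻¹ t ∈ S^{i(s⁻¹)}
      (∀ i s t → S i s → S i t →
        s ≈ t ⊎ ∃[ j ] (S j (s ⁻¹) × S j (s ⁻¹ ∙ t)))

    _∼_ : Carrier × Fin (suc K) → Carrier × Fin (suc K) → Set ℓ
    (g₁ , j₁) ∼ (g₂ , j₂) =
      (g₁ ≈ g₂ × j₁ ≡ j₂) ⊎ (S j₁ (g₁ ⁻¹ ∙ g₂) × S j₂ (g₂ ⁻¹ ∙ g₁))

    -- CayB: left vertices G (up to ≈), right vertices G × {1..K+1}
    -- up to ∼, edges {g, [g,i]}: g is adjacent to the class of x
    -- iff (g , i) ∼ x for some i.
    CayBEdge : Carrier → Carrier × Fin (suc K) → Set ℓ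
    CayBEdge g x = ∃[ i ] (g , i) ∼ x

    -- fL , fR (fR defined on representatives) form a graph isomorphism
    -- CayB(G,(Sⁱ)) ≅ Γ
    IsCayBIso : (Γ : BiGraph) → (Carrier → BiGraph.L Γ) →
                (Carrier × Fin (suc K) → BiGraph.R Γ) → Set (c ⊔ ℓ)
    IsCayBIso Γ fL fR =
      (∀ g h → g ≈ h → fL g ≡ fL h) ×
      (∀ g h → fL g ≡ fL h → g ≈ h) ×
      (∀ l → ∃[ g ] fL g ≡ l) ×
      (∀ x y → x ∼ y → fR x ≡ fR y) ×
      (∀ x y → fR x ≡ fR y → x ∼ y) ×
      (∀ r → ∃[ x ] fR x ≡ r) ×
      (∀ g x → CayBEdge g x ⇔ BiGraph.E Γ (fL g) (fR x))

{-# OPTIONS --safe #-}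
module Submission where

-- Since Λ acts simply transitively on L, the orbit map g ↦ g v₀ identifies Λ
-- with L, and every right vertex, having a neighbour g v₀, is of the form g vᵢ.
-- Two representatives (g, i), (h, j) give the same right vertex exactly when
-- g v₀ and h v₀ are equal or share that neighbour, which after translating by
-- g⁻¹ is the relation ∼.  The only input from acyclicity is that two distinct
-- left vertices have at most one common neighbour (no 4-cycles); it makes
-- g vᵢ = h vⱼ follow from ∼, makes the Sⁱ disjoint, and gives axiom (2).

open import Defs
open import Level using (Level; _⊔_)
open import Data.Nat using (ℕ; suc; _≤_; s≤s; z≤n)
open import Data.Fin using (Fin; zero; punchIn; punchOut; _≟_)
open import Data.Fin.Properties using (punchIn-injective; punchInᵢ≢i; punchIn-punchOut)
open import Data.Product using (_×_; _,_; proj₁; proj₂; ∃-syntax)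
open import Data.Sum using (_⊎_; inj₁; inj₂)
open import Data.Sum.Properties using (inj₁-injective; inj₂-injective)
open import Data.Empty using (⊥; ⊥-elim)
open import Data.List using ([]; _∷_)
open import Data.List.Relation.Unary.Linked using ([-]; _∷_)
open import Data.List.Relation.Unary.All using ([]; _∷_)
open import Data.List.Relation.Unary.AllPairs using ([]; _∷_)
open import Relation.Nullary using (¬_; Dec; yes; no)
open import Relation.Nullary.Decidable using (map′)
open import Relation.Binary.PropositionalEquality
  using (_≡_; _≢_; refl; sym; trans; cong; subst; module ≡-Reasoning)
open import Algebra.Bundles using (Group)
import Algebra.Properties.Group as GroupProperties
open import Function using (_∘_; _⇔_; mk⇔; Equivalence)

open Equivalence using (to; from)

Enumerates : ∀ {a p} {A : Set a} {n : ℕ} → (Fin n → A) → (A → Set p) → Set (a ⊔ p)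
Enumerates nb P =
  (∀ i j → nb i ≡ nb j → i ≡ j) × (∀ i → P (nb i)) × (∀ x → P x → ∃[ i ] nb i ≡ x)

module _ {a p} {A : Set a} {P : A → Set p} where

  Enumerates⇒≡-dec : ∀ {n} {nb : Fin n → A} → Enumerates nb P →
                     ∀ {x y} → P x → P y → Dec (x ≡ y)
  Enumerates⇒≡-dec {nb = nb} (inj , _ , cover) px py with cover _ px | cover _ py
  ... | i , refl | j , refl = map′ (cong nb) (inj i j) (i ≟ j)

  Enumerates-punchIn : ∀ {n} {nb : Fin (suc n) → A} {j₀ x₀} → Enumerates nb P →
                       nb j₀ ≡ x₀ → Enumerates (nb ∘ punchIn j₀) (λ x → P x × x ≢ x₀)
  Enumerates-punchIn {nb = nb} {j₀} (inj , mem , cover) refl =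
    (λ i j e → punchIn-injective j₀ i j (inj _ _ e)) ,
    (λ i → mem _ , punchInᵢ≢i j₀ i ∘ inj _ _) ,
    cover′
    where
    cover′ : ∀ x → P x × x ≢ nb j₀ → ∃[ i ] nb (punchIn j₀ i) ≡ x
    cover′ x (px , x≢) with cover x px
    ... | j , refl = punchOut j₀≢j , cong nb (punchIn-punchOut j₀≢j)
      where j₀≢j = λ j₀≡j → x≢ (cong nb (sym j₀≡j))

module _ (Γ : BiGraph) where
  open BiGraph Γ

  acyclic⇒no4Cycle : ¬ Cycle Γ → ∀ {a b x y} → a ≢ b → x ≢ y →
                     E a x → E b x → E a y → E b y → ⊥
  acyclic⇒no4Cycle acyclic {a} {b} {x} {y} a≢b x≢y ax bx ay by = acyclic
    ( inj₁ a , inj₂ x ∷ inj₁ b ∷ inj₂ y ∷ [] , s≤s (s≤s z≤n)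
    , ((λ ()) ∷ (a≢b ∘ inj₁-injective) ∷ (λ ()) ∷ [])
      ∷ ((λ ()) ∷ (x≢y ∘ inj₂-injective) ∷ [])
      ∷ ((λ ()) ∷ [])
      ∷ [] ∷ []
    , ax ∷ bx ∷ by ∷ ay ∷ [-])

  commonNeighbour-unique : ¬ Cycle Γ → ∀ {n a b x y} {nb : Fin n → R} →
                           NeighbourListL Γ n a nb → a ≢ b →
                           E a x → E b x → E a y → E b y → x ≡ y
  commonNeighbour-unique acyclic nbs a≢b ax bx ay by
    with Enumerates⇒≡-dec nbs ax ay
  ... | yes x≡y = x≡y
  ... | no x≢y  = ⊥-elim (acyclic⇒no4Cycle acyclic a≢b x≢y ax bx ay by)

module _ {c ℓ} (G : Group c ℓ) where
  open Group G renaming (sym to ≈-sym; trans to ≈-trans)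
  open GroupProperties G

  x⁻¹∙y≈ε⇔x≈y : ∀ {x y} → x ⁻¹ ∙ y ≈ ε ⇔ x ≈ y
  x⁻¹∙y≈ε⇔x≈y {x} {y} = mk⇔
    (λ p → ⁻¹-injective (inverseˡ-unique (x ⁻¹) y p))
    (λ p → ≈-trans (∙-congˡ (≈-sym p)) (inverseˡ x))

  x⁻¹≈ε⇒x≈ε : ∀ {x} → x ⁻¹ ≈ ε → x ≈ ε
  x⁻¹≈ε⇒x≈ε p = ⁻¹-injective (≈-trans p (≈-sym ε⁻¹≈ε))

module ActionProperties {c ℓ} (G : Group c ℓ) (Γ : BiGraph) (α : Action G Γ) where
  open Group G hiding (refl; sym; trans)
  open GroupProperties G using (\\-leftDividesˡ)
  open BiGraph Γ
  open Action α

  E-act : ∀ {l r} g → E l r → E (actL g l) (actR g r)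
  E-act {l} {r} g = to (act-E g l r)

  actR-inverseˡ : ∀ g r → actR (g ⁻¹) (actR g r) ≡ r
  actR-inverseˡ g r = begin
    actR (g ⁻¹) (actR g r)  ≡⟨ actR-∙ (g ⁻¹) g r ⟨
    actR (g ⁻¹ ∙ g) r       ≡⟨ actR-≈ (inverseˡ g) r ⟩
    actR ε r                ≡⟨ actR-ε r ⟩
    r                       ∎
    where open ≡-Reasoning

  actR-inverseʳ : ∀ g r → actR g (actR (g ⁻¹) r) ≡ r
  actR-inverseʳ g r = begin
    actR g (actR (g ⁻¹) r)  ≡⟨ actR-∙ g (g ⁻¹) r ⟨
    actR (g ∙ g ⁻¹) r       ≡⟨ actR-≈ (inverseʳ g) r ⟩
    actR ε r                ≡⟨ actR-ε r ⟩
    r                       ∎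
    where open ≡-Reasoning

  actR-injective : ∀ g {r r′} → actR g r ≡ actR g r′ → r ≡ r′
  actR-injective g {r} {r′} e = begin
    r                        ≡⟨ actR-inverseˡ g r ⟨
    actR (g ⁻¹) (actR g r)   ≡⟨ cong (actR (g ⁻¹)) e ⟩
    actR (g ⁻¹) (actR g r′)  ≡⟨ actR-inverseˡ g r′ ⟩
    r′                       ∎
    where open ≡-Reasoning

  E-unact : ∀ g {l r} → E (actL g l) r → E l (actR (g ⁻¹) r)
  E-unact g {l} {r} e = from (act-E g l _) (subst (E _) (sym (actR-inverseʳ g r)) e)

  actL-⁻¹∙ : ∀ g h x → actL g (actL (g ⁻¹ ∙ h) x) ≡ actL h x
  actL-⁻¹∙ g h x = trans (sym (actL-∙ g (g ⁻¹ ∙ h) x)) (actL-≈ (\\-leftDividesˡ g h) x)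

  E-translate : ∀ g h x r → E (actL (g ⁻¹ ∙ h) x) r ⇔ E (actL h x) (actR g r)
  E-translate g h x r = mk⇔
    (subst (λ l → E l _) (actL-⁻¹∙ g h x) ∘ to (act-E g _ r))
    (from (act-E g _ r) ∘ subst (λ l → E l _) (sym (actL-⁻¹∙ g h x)))

  module Orbit (simplyTransitive : SimplyTransitiveOnL G Γ α) (x : L) where
    private
      transitive = proj₁ simplyTransitive
      free       = proj₂ simplyTransitive

    orbit-≡⇔≈ : ∀ {g h} → actL g x ≡ actL h x ⇔ g ≈ h
    orbit-≡⇔≈ = mk⇔ (free _ _ x) (λ p → actL-≈ p x)

    fixes⇔≈ε : ∀ {g} → actL g x ≡ x ⇔ g ≈ ε
    fixes⇔≈ε = mk⇔
      (λ e → to orbit-≡⇔≈ (trans e (sym (actL-ε x))))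
      (λ p → trans (from orbit-≡⇔≈ p) (actL-ε x))

    HasSize-orbit : ∀ {p k} {P : L → Set p} {Q : Carrier → Set ℓ} {u : Fin k → L} →
                    Enumerates u P → (∀ s → Q s ⇔ P (actL s x)) → HasSize G k Q
    HasSize-orbit {P = P} {Q} {u} (inj , mem , cover) Q⇔P = e , Q-e , e-inj , e-cover
      where
      e : Fin _ → Carrier
      e j = proj₁ (transitive x (u j))

      e-orbit : ∀ j → actL (e j) x ≡ u j
      e-orbit j = proj₂ (transitive x (u j))

      Q-e : ∀ j → Q (e j)
      Q-e j = from (Q⇔P (e j)) (subst P (sym (e-orbit j)) (mem j))

      e-inj : ∀ i j → e i ≈ e j → i ≡ j
      e-inj i j p = inj i j (trans (sym (e-orbit i)) (trans (actL-≈ p x) (e-orbit j)))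

      e-cover : ∀ s → Q s → ∃[ j ] e j ≈ s
      e-cover s q with cover _ (to (Q⇔P s) q)
      ... | j , p = j , free _ _ x (trans (e-orbit j) p)

module BiCayleyOfTree {c ℓ} {K k : ℕ} (T : BiGraph) (acyclic : ¬ Cycle T)
    (biregular : IsBiregular T (suc K) (suc k))
    (Λ : Group c ℓ) (α : Action Λ T) (simplyTransitive : SimplyTransitiveOnL Λ T α)
    (v₀ : BiGraph.L T) (v : Fin (suc K) → BiGraph.R T)
    (v-enum : NeighbourListL T (suc K) v₀ v) where
  open BiGraph T
  open Group Λ renaming (refl to ≈-refl; sym to ≈-sym; trans to ≈-trans)
  open Action α
  open ActionProperties Λ T α
  open Orbit simplyTransitive v₀

  private
    transitive = proj₁ simplyTransitive
    v-inj      = proj₁ v-enum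
    v-adj      = proj₁ (proj₂ v-enum)
    v-cover    = proj₂ (proj₂ v-enum)

  S : Fin (suc K) → Carrier → Set ℓ
  S i s = ¬ (s ≈ ε) × E (actL s v₀) (v i)

  fR : Carrier × Fin (suc K) → R
  fR (g , i) = actR g (v i)

  edge-orbit : ∀ g i → E (actL g v₀) (fR (g , i))
  edge-orbit g i = E-act g (v-adj i)

  neighbour-orbit : ∀ g {r} → E (actL g v₀) r → ∃[ i ] fR (g , i) ≡ r
  neighbour-orbit g {r} e with v-cover _ (E-unact g e)
  ... | i , p = i , trans (cong (actR g) p) (actR-inverseʳ g r)

  S-⁻¹∙⇔ : ∀ {g h i} → S i (g ⁻¹ ∙ h) ⇔ (actL g v₀ ≢ actL h v₀ × E (actL h v₀) (fR (g , i)))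
  S-⁻¹∙⇔ {g} {h} {i} = mk⇔
    (λ (n , e) → n ∘ from (x⁻¹∙y≈ε⇔x≈y Λ) ∘ to orbit-≡⇔≈ , to (E-translate g h v₀ (v i)) e)
    (λ (n , e) → n ∘ from orbit-≡⇔≈ ∘ to (x⁻¹∙y≈ε⇔x≈y Λ) , from (E-translate g h v₀ (v i)) e)

  -- j is the index of s⁻¹ vᵢ among the neighbours of v₀.
  S-⁻¹ : ∀ {i s} → S i s → ∃[ j ] (S j (s ⁻¹) × fR (s , j) ≡ v i)
  S-⁻¹ {i} {s} (s≉ε , e) with v-cover _ (E-unact s e)
  ... | j , p =
    j , (s≉ε ∘ x⁻¹≈ε⇒x≈ε Λ , subst (E _) (sym p) (E-act (s ⁻¹) (v-adj i))) ,
    trans (cong (actR s) p) (actR-inverseʳ s (v i))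

  S-closed : ∀ i s t → s ≈ t → S i s → S i t
  S-closed i s t p (s≉ε , e) = s≉ε ∘ ≈-trans p , subst (λ l → E l (v i)) (actL-≈ p v₀) e

  S-size : ∀ i → HasSize Λ k (S i)
  S-size i with proj₂ biregular (v i)
  ... | nb , nb-enum with proj₂ (proj₂ nb-enum) v₀ (v-adj i)
  ... | j₀ , nb-j₀ = HasSize-orbit
    (Enumerates-punchIn nb-enum nb-j₀)
    (λ s → mk⇔ (λ (s≉ε , e) → e , s≉ε ∘ to fixes⇔≈ε)
               (λ (e , moves) → moves ∘ from fixes⇔≈ε , e))

  S-disjoint : ∀ i j s → S i s → S j s → i ≡ j
  S-disjoint i j s (s≉ε , ei) (_ , ej) =
    v-inj i j (commonNeighbour-unique T acyclic v-enum (s≉ε ∘ to fixes⇔≈ε ∘ sym)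
                 (v-adj i) ei (v-adj j) ej)

  S-inverse-closed : ∀ s → _∈S Λ S s → _∈S Λ S (s ⁻¹)
  S-inverse-closed s (i , sᵢ) with S-⁻¹ sᵢ
  ... | j , s⁻¹ⱼ , _ = j , s⁻¹ⱼ

  ε∉S : ¬ _∈S Λ S ε
  ε∉S (_ , ε≉ε , _) = ε≉ε ≈-refl

  S-axiom₂ : ∀ i s t → S i s → S i t → s ≈ t ⊎ ∃[ j ] (S j (s ⁻¹) × S j (s ⁻¹ ∙ t))
  S-axiom₂ i s t sᵢ@(_ , es) (_ , et)
    with Enumerates⇒≡-dec (proj₂ (proj₂ biregular (v i))) es et
  ... | yes p = inj₁ (to orbit-≡⇔≈ p)
  ... | no q with S-⁻¹ sᵢ
  ...   | j , s⁻¹ⱼ , sⱼ≡i = inj₂ (j , s⁻¹ⱼ , from S-⁻¹∙⇔ (q , subst (E _) (sym sⱼ≡i) et))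

  biCayley : BiCayley Λ S k
  biCayley = S-closed , S-size , S-disjoint , S-inverse-closed , ε∉S , S-axiom₂

  fR-respects-∼ : ∀ x y → _∼_ Λ S x y → fR x ≡ fR y
  fR-respects-∼ (g , i) (h , .i) (inj₁ (g≈h , refl)) = actR-≈ g≈h (v i)
  fR-respects-∼ (g , i) (h , j) (inj₂ (gh , hg)) with to S-⁻¹∙⇔ gh | to S-⁻¹∙⇔ hg
  ... | g≢h , h~gvᵢ | _ , g~hvⱼ =
    commonNeighbour-unique T acyclic (proj₂ (proj₁ biregular (actL g v₀))) g≢h
      (edge-orbit g i) h~gvᵢ g~hvⱼ (edge-orbit h j)

  fR-injective : ∀ x y → fR x ≡ fR y → _∼_ Λ S x y
  fR-injective (g , i) (h , j) e =
    decide (Enumerates⇒≡-dec (proj₂ (proj₂ biregular (fR (g , i)))) (edge-orbit g i) h~gvᵢ)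
    where
    h~gvᵢ : E (actL h v₀) (fR (g , i))
    h~gvᵢ = subst (E (actL h v₀)) (sym e) (edge-orbit h j)

    decide : Dec (actL g v₀ ≡ actL h v₀) → _∼_ Λ S (g , i) (h , j)
    decide (yes p) =
      inj₁ (g≈h , v-inj i j (actR-injective g (trans e (actR-≈ (≈-sym g≈h) (v j)))))
      where g≈h = to orbit-≡⇔≈ p
    decide (no q) =
      inj₂ (from S-⁻¹∙⇔ (q , h~gvᵢ) , from S-⁻¹∙⇔ (q ∘ sym , subst (E _) e (edge-orbit g i)))

  fR-surjective : ∀ r → ∃[ x ] fR x ≡ r
  fR-surjective r with proj₂ biregular r
  ... | nb , _ , nb-adj , _ with transitive v₀ (nb zero)
  ... | g , gv₀≡nb₀ with neighbour-orbit g (subst (λ l → E l r) (sym gv₀≡nb₀) (nb-adj zero))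
  ... | i , gvᵢ≡r = (g , i) , gvᵢ≡r

  edge⇔ : ∀ g x → CayBEdge Λ S g x ⇔ E (actL g v₀) (fR x)
  edge⇔ g x = mk⇔
    (λ (i , g∼x) → subst (E _) (fR-respects-∼ (g , i) x g∼x) (edge-orbit g i))
    (λ e → let (i , gvᵢ≡fRx) = neighbour-orbit g e in i , fR-injective (g , i) x gvᵢ≡fRx)

  cayleyBigraph≅T : IsCayBIso Λ S T (λ g → actL g v₀) fR
  cayleyBigraph≅T =
    (λ _ _ → from orbit-≡⇔≈) , (λ _ _ → to orbit-≡⇔≈) , transitive v₀ ,
    fR-respects-∼ , fR-injective , fR-surjective , edge⇔

theorem2p9 : {c ℓ : Level} (K k : ℕ) → k ≤ K →
    (T : BiGraph) → IsBiregularTree T (suc K) (suc k) →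
    (Λ : Group c ℓ) → (α : Action Λ T) → SimplyTransitiveOnL Λ T α →
    (v₀ : BiGraph.L T) → (v : Fin (suc K) → BiGraph.R T) →
    NeighbourListL T (suc K) v₀ v →
    let open Group Λ
        open Action α
        S : Fin (suc K) → Carrier → Set ℓ
        S i s = ¬ (s ≈ ε) × BiGraph.E T (actL s v₀) (v i)
    in BiCayley Λ S k ×
       IsCayBIso Λ S T (λ g → actL g v₀) (λ x → actR (proj₁ x) (v (proj₂ x)))
theorem2p9 K k _ T ((_ , acyclic) , biregular) Λ α simplyTransitive v₀ v v-enum =
  biCayley , cayleyBigraph≅T
  where open BiCayleyOfTree T acyclic biregular Λ α simplyTransitive v₀ v v-enum
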